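{- Let $A,Z$ be sets, $\cdot$ a partial function $A\times A\to A$, $.$ a partial function $A\times Z\to Z$, $\partial\colon Z\to Z$ a function, and $|\cdot|$ a function from $Z$ to a linearly ordered set $(D,\leq)$. Consider the conditions: (a) if $a\,.\,(b\,.\,z)$ and $(a\cdot b)\,.\,z$ are defined for $a,b\in A$, $z\in Z$, then $a\,.\,(b\,.\,z)=(a\cdot b)\,.\,z$; (b) if $a\,.\,z$ and $a\,.\,\partial z$ are defined for $a\in A$, $z\in Z$, then $\partial(a\,.\,z)=a\,.\,\partial z$; (c) $|\partial z|\leq|z|$ for each $z\in Z$; (d) if $|y|\leq|z|$ and $a\,.\,y$ and $a\,.\,z$ are defined for $a\in A$, $y,z\in Z$, then $|a\,.\,y|\leq|a\,.\,z|$; (e) if $|y|\leq|z|$ for $y,z\in Z$, then for every $a\in A$, if $a\,.\,z$ is defined then so is $a\,.\,y$. Then: (i) if $(A,Z,\cdot,.,\partial,|\cdot|)$ fulfills (a)–(e), then $(A,Z)$ with $\cdot$, $.$, $\partial$, $|\cdot|$ is a normed background; (ii) if $(A,Z)$ with $\cdot$, $.$, $\partial$, $|\cdot|$ is a normed background, then there is a function $|\cdot|_1$ on $Z$ (into some linear order) such that $(A,Z,\cdot,.,\partial,|\cdot|_1)$ fulfills (a)–(e).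
   Context: A local actoid $(A,Z)$ consists of sets $A,Z$, a partial binary function $A\times A\to A$, $(a,b)\mapsto a\cdot b$, and a partial binary function $A\times Z\to Z$, $(a,z)\mapsto a\,.\,z$, such that whenever $a\,.\,(b\,.\,z)$ and $(a\cdot b)\,.\,z$ are both defined they are equal. A background is a local actoid with a function $\partial\colon Z\to Z$ such that whenever $a\,.\,z$ is defined, $a\,.\,\partial z$ is defined and $a\,.\,\partial z=\partial(a\,.\,z)$. A background is normed (with norm $|\cdot|$) if there is a function $|\cdot|\colon Z\to D$ into a linear order $(D,\leq)$ such that for $x,y\in Z$ with $|x|\leq|y|$ and all $a\in A$: if $a\,.\,y$ is defined then $a\,.\,x$ is defined and $|a\,.\,x|\leq|a\,.\,y|$. -}

module Defs where

open import Level using (Level; 0ℓ; suc)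
open import Data.Maybe using (Maybe; just; nothing; _>>=_)
open import Data.Product using (Σ; ∃; _×_; _,_)
open import Relation.Binary.PropositionalEquality using (_≡_)
open import Relation.Binary.Bundles using (TotalOrder)

-- Partial functions are modelled as Maybe-valued functions:
--   a · b   is  mult a b : Maybe A      (nothing = undefined)
--   a . z   is  act a z  : Maybe Z
-- "x is defined with value u" is  x ≡ just u.

module _ {A Z : Set} (mult : A → A → Maybe A) (act : A → Z → Maybe Z) where

  actAfterAct : A → A → Z → Maybe Z
  actAfterAct a b z = act b z >>= act a

  actOfProd : A → A → Z → Maybe Z
  actOfProd a b z = mult a b >>= λ c → act c z

  IsLocalActoid : Set
  IsLocalActoid = ∀ a b z u v →
    actAfterAct a b z ≡ just u → actOfProd a b z ≡ just v → u ≡ v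

  module _ (∂ : Z → Z) where

    IsBackgroundAxiom : Set
    IsBackgroundAxiom = ∀ a z w → act a z ≡ just w → act a (∂ z) ≡ just (∂ w)

    IsBackground : Set
    IsBackground = IsLocalActoid × IsBackgroundAxiom

    module _ {c ℓ₁ ℓ₂ : Level} (D : TotalOrder c ℓ₁ ℓ₂) where
      open TotalOrder D renaming (Carrier to Dc)

      module _ (norm : Z → Dc) where

        IsNormAxiom : Set (ℓ₂)
        IsNormAxiom = ∀ x y a w → norm x ≤ norm y → act a y ≡ just w →
          Σ Z λ v → act a x ≡ just v × norm v ≤ norm w

        IsNormedBackground : Set ℓ₂
        IsNormedBackground = IsBackground × IsNormAxiom

        CondA : Set
        CondA = IsLocalActoid

        CondB : Set
        CondB = ∀ a z w w' → act a z ≡ just w → act a (∂ z) ≡ just w' → ∂ w ≡ w'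

        CondC : Set ℓ₂
        CondC = ∀ z → norm (∂ z) ≤ norm z

        CondD : Set ℓ₂
        CondD = ∀ a y z u v → norm y ≤ norm z →
          act a y ≡ just u → act a z ≡ just v → norm u ≤ norm v

        CondE : Set ℓ₂
        CondE = ∀ y z a w → norm y ≤ norm z → act a z ≡ just w →
          ∃ λ u → act a y ≡ just u

        FulfillsAtoE : Set ℓ₂
        FulfillsAtoE = CondA × CondB × CondC × CondD × CondE

module Submission where

-- (i)  From (a)–(e): (a) is the actoid axiom; the background axiom follows
--      because (c) and (e) make a.∂z defined whenever a.z is, and (b) then
--      identifies it with ∂(a.z); the norm axiom is (e) together with (d).
-- (ii) In a normed background, (a), (b), (d), (e) are consequences of the
--      axioms for every norm compatible with the action, but (c) may fail
--      for the given norm.  We therefore replace |·| by the total preorder ⊑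
--      generated by  y ◁ z :⇔ |y| ≤ |∂ⁿz| for some n.  Then ∂z ◁ z gives (c);
--      ◁ is total because ≤ is; and ◁ "transports" along the action
--      (a.z defined ⇒ a.y defined and a.y ◁ a.z), by the norm axiom and the
--      background axiom iterated n times.  Transport passes to the
--      reflexive–transitive closure ⊑, which yields (d) and (e).  Finally any
--      total preorder becomes a total order on a lifted copy of Z whose
--      equality is mutual comparability, and ⊑ is taken as the new norm.

open import Defs
open import Level using (Level; _⊔_; 0ℓ; suc; Lift; lift; lower)
open import Data.Maybe using (Maybe; just)
open import Data.Maybe.Properties using (just-injective)
open import Data.Nat using (zero) renaming (suc to 1+)
open import Data.Nat.GeneralisedArithmetic using (fold)
open import Data.Product using (Σ; ∃; _×_; _,_; proj₁; proj₂)
open import Data.Sum using (map)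
open import Relation.Binary.Core using (Rel)
open import Relation.Binary.Definitions using (Reflexive; Transitive; Total)
open import Relation.Binary.Bundles using (TotalOrder)
open import Relation.Binary.PropositionalEquality using (_≡_; sym; trans; subst)
open import Relation.Binary.Construct.Closure.ReflexiveTransitive using (Star; ε; _◅_; _◅◅_)
import Relation.Binary.Construct.Interior.Symmetric as SymInterior

module _ {a ℓ : Level} (ℓ′ : Level) {Z : Set a} (_≼_ : Rel Z ℓ)
         (≼-refl : Reflexive _≼_) (≼-trans : Transitive _≼_) (≼-total : Total _≼_) where

  _≼↑_ : Rel (Lift ℓ′ Z) (ℓ ⊔ ℓ′)
  x ≼↑ y = Lift ℓ′ (lower x ≼ lower y)

  liftedTotalOrder : TotalOrder (a ⊔ ℓ′) (ℓ ⊔ ℓ′) (ℓ ⊔ ℓ′)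
  liftedTotalOrder = record
    { isTotalOrder = record
      { isPartialOrder = SymInterior.isPartialOrder {R = _≼↑_} (lift ≼-refl) ≼↑-trans
      ; total          = λ x y → map lift lift (≼-total (lower x) (lower y))
      }
    }
    where
    ≼↑-trans : Transitive _≼↑_
    ≼↑-trans (lift p) (lift q) = lift (≼-trans p q)

module _ {A Z : Set} (mult : A → A → Maybe A) (act : A → Z → Maybe Z) (∂ : Z → Z) where

  module _ {c ℓ₁ ℓ₂ : Level} (D : TotalOrder c ℓ₁ ℓ₂) (norm : Z → TotalOrder.Carrier D) where

    -- |∂z| ≤ |z| and (e) make a.∂z defined when a.z is; (b) identifies it.
    conditions⇒backgroundAxiom :
      CondB mult act ∂ D norm → CondC mult act ∂ D norm → CondE mult act ∂ D norm →
      IsBackgroundAxiom mult act ∂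
    conditions⇒backgroundAxiom cb cc ce a z w az≡w
      with ce (∂ z) z a w (cc z) az≡w
    ... | w′ , a∂z≡w′ = subst (λ t → act a (∂ z) ≡ just t) (sym (cb a z w w′ az≡w a∂z≡w′)) a∂z≡w′

    conditions⇒normAxiom :
      CondD mult act ∂ D norm → CondE mult act ∂ D norm → IsNormAxiom mult act ∂ D norm
    conditions⇒normAxiom cd ce x y a w |x|≤|y| ay≡w
      with ce x y a w |x|≤|y| ay≡w
    ... | v , ax≡v = v , ax≡v , cd a x y v w |x|≤|y| ax≡v ay≡w

    conditions⇒normedBackground :
      FulfillsAtoE mult act ∂ D norm → IsNormedBackground mult act ∂ D norm
    conditions⇒normedBackground (ca , cb , cc , cd , ce) =
      (ca , conditions⇒backgroundAxiom cb cc ce) , conditions⇒normAxiom cd ce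

  -- A relation R on Z is transported by the action if a.y defined and x R y
  -- imply a.x defined and (a.x) R (a.y); this is the common shape of (d)+(e).
  Transports : {ℓ : Level} → Rel Z ℓ → Set ℓ
  Transports R = ∀ {x y} a w → R x y → act a y ≡ just w → Σ Z λ v → act a x ≡ just v × R v w

  star-transports : {ℓ : Level} {R : Rel Z ℓ} → Transports R → Transports (Star R)
  star-transports tr a w ε ay≡w = w , ay≡w , ε
  star-transports tr a w (xRx′ ◅ x′R*y) ay≡w with star-transports tr a w x′R*y ay≡w
  ... | v′ , ax′≡v′ , v′R*w with tr a v′ xRx′ ax′≡v′
  ... | v , ax≡v , vRv′ = v , ax≡v , (vRv′ ◅ v′R*w)

  act-∂ⁿ : IsBackgroundAxiom mult act ∂ →
           ∀ n a {z w} → act a z ≡ just w → act a (fold z ∂ n) ≡ just (fold w ∂ n)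
  act-∂ⁿ bg zero    a az≡w = az≡w
  act-∂ⁿ bg (1+ n) a az≡w = bg a _ _ (act-∂ⁿ bg n a az≡w)

  module _ (D : TotalOrder 0ℓ 0ℓ 0ℓ) (norm : Z → TotalOrder.Carrier D)
           (nb : IsNormedBackground mult act ∂ D norm) where
    open TotalOrder D using (_≤_) renaming (refl to ≤-refl; total to ≤-total)

    background : IsBackgroundAxiom mult act ∂
    background = proj₂ (proj₁ nb)

    normAxiom : IsNormAxiom mult act ∂ D norm
    normAxiom = proj₂ nb

    _◁_ : Rel Z 0ℓ
    y ◁ z = ∃ λ n → norm y ≤ norm (fold z ∂ n)

    _⊑_ : Rel Z 0ℓ
    _⊑_ = Star _◁_

    -- If |y| ≤ |∂ⁿz| and a.z = w, then a.∂ⁿz = ∂ⁿw and the norm axiom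
    -- gives a.y = v with |v| ≤ |∂ⁿw|.
    ◁-transports : Transports _◁_
    ◁-transports a w (n , |y|≤|∂ⁿz|) az≡w
      with normAxiom _ _ a _ |y|≤|∂ⁿz| (act-∂ⁿ background n a az≡w)
    ... | v , ay≡v , |v|≤|∂ⁿw| = v , ay≡v , (n , |v|≤|∂ⁿw|)

    ⊑-transports : Transports _⊑_
    ⊑-transports = star-transports ◁-transports

    -- Already the step n = 0 relates any two elements, by totality of ≤.
    ⊑-total : Total _⊑_
    ⊑-total y z = map (λ |y|≤|z| → (0 , |y|≤|z|) ◅ ε) (λ |z|≤|y| → (0 , |z|≤|y|) ◅ ε)
                      (≤-total (norm y) (norm z))

    -- Condition (c) for the new norm: the step n = 1.
    ∂-⊑ : ∀ z → ∂ z ⊑ z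
    ∂-⊑ z = (1 , ≤-refl) ◅ ε

    D₁ : TotalOrder (suc 0ℓ) (suc 0ℓ) (suc 0ℓ)
    D₁ = liftedTotalOrder (suc 0ℓ) _⊑_ ε _◅◅_ ⊑-total

    norm₁ : Z → TotalOrder.Carrier D₁
    norm₁ = lift

    normedBackground⇒conditions : FulfillsAtoE mult act ∂ D₁ norm₁
    normedBackground⇒conditions = proj₁ (proj₁ nb) , cb , (λ z → lift (∂-⊑ z)) , cd , ce
      where
      -- The background axiom computes a.∂z, so it must equal ∂(a.z).
      cb : CondB mult act ∂ D₁ norm₁
      cb a z w w′ az≡w a∂z≡w′ = just-injective (trans (sym (background a z w az≡w)) a∂z≡w′)

      -- Transport yields a.y ⊑ a.z, and a.y is determined uniquely.
      cd : CondD mult act ∂ D₁ norm₁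
      cd a y z u v (lift y⊑z) ay≡u az≡v with ⊑-transports a v y⊑z az≡v
      ... | u′ , ay≡u′ , u′⊑v = lift (subst (_⊑ v) (just-injective (trans (sym ay≡u′) ay≡u)) u′⊑v)

      ce : CondE mult act ∂ D₁ norm₁
      ce y z a w (lift y⊑z) az≡w with ⊑-transports a w y⊑z az≡w
      ... | u , ay≡u , _ = u , ay≡u

lemma4p5 : ((A Z : Set) (mult : A → A → Maybe A) (act : A → Z → Maybe Z) (∂ : Z → Z)
    (D : TotalOrder 0ℓ 0ℓ 0ℓ) (norm : Z → TotalOrder.Carrier D) →
    FulfillsAtoE mult act ∂ D norm → IsNormedBackground mult act ∂ D norm)
    × ((A Z : Set) (mult : A → A → Maybe A) (act : A → Z → Maybe Z) (∂ : Z → Z)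
    (D : TotalOrder 0ℓ 0ℓ 0ℓ) (norm : Z → TotalOrder.Carrier D) →
    IsNormedBackground mult act ∂ D norm →
    Σ (TotalOrder (suc 0ℓ) (suc 0ℓ) (suc 0ℓ)) λ D₁ →
    Σ (Z → TotalOrder.Carrier D₁) λ norm₁ → FulfillsAtoE mult act ∂ D₁ norm₁)
lemma4p5 = (λ A Z mult act ∂ D norm → conditions⇒normedBackground mult act ∂ D norm)
         , (λ A Z mult act ∂ D norm nb →
              D₁ mult act ∂ D norm nb , norm₁ mult act ∂ D norm nb ,
              normedBackground⇒conditions mult act ∂ D norm nb)
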